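{- For every $k\ge1$ and $(s_1,\dots,s_k)\in\mathbb Z_{\ge1}^k$, the element $(\pi\otimes\pi)\Delta^{ch}(\Phi^{s_1,\dots,s_k}_{i_1,\dots,i_k})\in\mathcal H\otimes\mathcal H$ does not depend on the choice of the pairwise distinct indices $i_1,\dots,i_k\in\mathbb Z_{\ge1}$.
   Context: Let $\{x_i\}_{i\ge1}$ be variables. For $k\ge1$, distinct $i_1,\dots,i_k\in\mathbb Z_{\ge1}$ and $(s_1,\dots,s_k)\in\mathbb Z_{\ge1}^k$, the Chen fraction is $\Phi^{s_1,\dots,s_k}_{i_1,\dots,i_k}:=\frac{1}{(x_{i_1}+\dots+x_{i_k})^{s_1}(x_{i_2}+\dots+x_{i_k})^{s_2}\cdots x_{i_k}^{s_k}}$. Let $F^{ch}$ be the set of Chen fractions together with $1$, and $\mathbb Q F^{ch}$ its span, in which $F^{ch}$ is a basis. Let $\partial_i:=-\frac{\partial}{\partial x_i}$, $d_{i,j}:=\partial_i-\partial_j$, and for indices $i_1,\dots,i_k$ set $d_{i_1,i_0}:=\partial_{i_1}$. Operators act on tensors factorwise. $\Delta^{ch}:\mathbb Q F^{ch}\to\mathbb Q F^{ch}\otimes\mathbb Q F^{ch}$ is the linear map with $\Delta^{ch}(1)=1\otimes1$, $\Delta^{ch}(\Phi^{1,\dots,1}_{i_1,\dots,i_k})=\sum_{j=0}^k\Phi^{1,\dots,1}_{i_1,\dots,i_j}\otimes\Phi^{1,\dots,1}_{i_{j+1},\dots,i_k}$ (empty index list meaning $1$), and recursively $\Delta^{ch}(\Phi^{s_1,\dots,s_j+1,\dots,s_k}_{i_1,\dots,i_k})=\frac1{s_j}(\mathrm{id}\otimes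 d_{i_j,i_{j-1}}+d_{i_j,i_{j-1}}\otimes\mathrm{id})\Delta^{ch}(\Phi^{s_1,\dots,s_k}_{i_1,\dots,i_k})$ (well defined). Let $\mathcal H$ be the $\mathbb Q$-vector space with basis a symbol $\mathbf 1$ and symbols $[s_1,\dots,s_k]$, $k\ge1$, $s_j\in\mathbb Z_{\ge1}$, and $\pi:\mathbb Q F^{ch}\to\mathcal H$ the linear map with $\pi(1)=\mathbf 1$, $\pi(\Phi^{s_1,\dots,s_k}_{i_1,\dots,i_k})=[s_1,\dots,s_k]$. -}

module Defs where

open import Data.Nat as ℕ using (ℕ; zero; suc; _∸_)
open import Data.Integer using (+_)
open import Data.Rational using (ℚ; 0ℚ; 1ℚ; _/_; _+_; _*_; -_)
open import Data.List using (List; []; _∷_; [_]; map; _++_; take; drop; length; upTo; foldr; concatMap)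
open import Data.List.Properties using (≡-dec)
open import Data.Product using (_×_; _,_; proj₁; proj₂)
open import Data.Maybe using (Maybe; just; nothing)
open import Data.Bool using (Bool; true; false; if_then_else_; _∨_)
open import Relation.Nullary using (yes; no)
open import Relation.Nullary.Decidable using (⌊_⌋)
open import Relation.Binary.PropositionalEquality using (_≡_)

-- Chen fractions.
-- A basis element of ℚF^ch is encoded as a list of pairs
--   (i₁ , s₁) ∷ … ∷ (i_k , s_k) ∷ []   ↦   Φ^{s₁,…,s_k}_{i₁,…,i_k}
-- and the empty list encodes the fraction 1.

Gen : Set
Gen = List (ℕ × ℕ)

ℕtoℚ : ℕ → ℚ
ℕtoℚ n = + n / 1

-- Elements of ℚF^ch, as finite formal ℚ-linear combinations of basis elements.
Lin : Set
Lin = List (ℚ × Gen)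

-- Elements of ℚF^ch ⊗ ℚF^ch, as formal combinations of pure tensors of basis elements.
Tens : Set
Tens = List (ℚ × Gen × Gen)

memb : ℕ → Gen → Bool
memb i [] = false
memb i ((j , _) ∷ g) = ⌊ i ℕ.≟ j ⌋ ∨ memb i g

prefix : ℕ × ℕ → ℚ × Gen → ℚ × Gen
prefix p (c , g) = c , p ∷ g

-- ∂_i = - ∂/∂x_i applied to a Chen fraction.  If i = i_p then
--   ∂_i Φ^{s}_{i} = Σ_{q ≤ p} s_q Φ^{s₁,…,s_q+1,…,s_k}_{i},
-- and ∂_i Φ = 0 if i does not occur.
∂ : ℕ → Gen → Lin
∂ i [] = []
∂ i ((j , s) ∷ g) with i ℕ.≟ j
... | yes _ = [ (ℕtoℚ s , (j , suc s) ∷ g) ]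
... | no _ = if memb i g
               then (ℕtoℚ s , (j , suc s) ∷ g) ∷ map (prefix (j , s)) (∂ i g)
               else []

negL : Lin → Lin
negL = map (λ { (c , g) → (- c , g) })

-- d_{a,b} = ∂_a - ∂_b ; with b = nothing encoding the convention d_{i₁,i₀} = ∂_{i₁}.
d : ℕ → Maybe ℕ → Gen → Lin
d a nothing g = ∂ a g
d a (just b) g = ∂ a g ++ negL (∂ b g)

L : ℕ → Maybe ℕ → Tens → Tens
L a b = concatMap λ { (c , g , h) →
          map (λ { (c' , h') → (c * c' , g , h') }) (d a b h)
       ++ map (λ { (c' , g') → (c * c' , g' , h) }) (d a b g) }

scale : ℚ → Tens → Tens
scale q = map (λ { (c , g , h) → (q * c , g , h) })

-- Δ^ch(Φ^{1,…,1}_{i₁,…,i_k}) = Σ_j Φ^{1..1}_{i₁..i_j} ⊗ Φ^{1..1}_{i_{j+1}..i_k}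
Δbase : List ℕ → Tens
Δbase is = map (λ j → (1ℚ , take j g , drop j g)) (upTo (suc (length is)))
  where g = map (λ i → (i , 1)) is

-- raise i p t n X : apply n recursion steps at a position with index i and
-- previous index p, the exponent going from (suc t) to (suc t)+1, then onwards:
--   X ↦ (1/(suc t)) (id ⊗ d_{i,p} + d_{i,p} ⊗ id) X
raise : ℕ → Maybe ℕ → ℕ → ℕ → Tens → Tens
raise i p t zero X = X
raise i p t (suc n) X = raise i p (suc t) n (scale (+ 1 / suc t) (L i p X))

-- Δ^ch, computed by starting from Δ^ch(Φ^{1,…,1}) and raising the exponents
-- position by position (left to right) via the defining recursion
-- (the paper asserts the recursion is well defined, so any order gives Δ^ch).
Δch : Gen → Tens
Δch g = go nothing g (Δbase (map proj₁ g))
  where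
  go : Maybe ℕ → Gen → Tens → Tens
  go p [] X = X
  go p ((i , s) ∷ r) X = go (just i) r (raise i p 0 (s ∸ 1) X)

-- The space 𝓗: basis 𝟏 (encoded as []) and [s₁,…,s_k] (nonempty lists).

HBasis : Set
HBasis = List ℕ

-- Elements of 𝓗 ⊗ 𝓗 as formal combinations of pure tensors of basis elements.
HTens : Set
HTens = List (ℚ × HBasis × HBasis)

π : Gen → HBasis
π = map proj₂

π⊗π : Tens → HTens
π⊗π = map (λ { (c , g , h) → (c , π g , π h) })

coeff : HBasis → HBasis → HTens → ℚ
coeff a b [] = 0ℚ
coeff a b ((c , u , v) ∷ X) with ≡-dec ℕ._≟_ a u | ≡-dec ℕ._≟_ b v
... | yes _ | yes _ = c + coeff a b X
... | _ | _ = coeff a b X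

_≈H_ : HTens → HTens → Set
X ≈H Y = ∀ a b → coeff a b X ≡ coeff a b Y

open import Data.Vec using (Vec; toList; zip)

Φ : ∀ {k} → Vec ℕ k → Vec ℕ k → Gen
Φ is ss = toList (zip is ss)

{-# OPTIONS --safe #-}
module Submission where

-- Δch inspects the indices i₁,…,i_k only through equality tests between them
-- (in ∂ and d). A relabelling of indices that preserves and reflects equality,
-- here i_m ↦ j_m, which is a bijection since both index vectors are
-- repetition-free, therefore transports every intermediate linear combination
-- term by term, with the same coefficients and exponents. After π, which forgets
-- the indices, the two sides are the same list.

open import Defs
open import Data.Nat using (ℕ; _≤_; _≟_; suc; _∸_)
open import Data.Integer using (+_)
open import Data.Rational using (ℚ; 1ℚ; _/_; _*_; -_)
open import Data.List using (List; []; _∷_; map; take; drop; length; upTo)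
open import Data.List.Relation.Binary.Pointwise as Listʷ
  using (Pointwise; []; _∷_; map⁺; ++⁺; Pointwise-length; Pointwise-≡⇒≡)
open import Data.Maybe using (Maybe; just; nothing)
import Data.Maybe.Relation.Binary.Pointwise as Maybeʷ
open import Data.Product using (_×_; _,_; proj₁; proj₂)
open import Data.Product.Relation.Binary.Pointwise.NonDependent renaming (Pointwise to _×ʳ_)
open import Data.Bool using (true; false; _∨_)
open import Function using (_∘_)
open import Relation.Nullary using (contradiction)
open import Data.Fin using (zero; suc)
open import Data.Vec using (Vec; lookup; []; _∷_)
open import Data.Vec.Relation.Unary.All using (All)
open import Data.Vec.Relation.Unary.Unique.Propositional using (Unique)
open import Data.Vec.Relation.Unary.Unique.Propositional.Properties using (lookup-injective)
open import Relation.Nullary.Decidable using (⌊_⌋; yes; no)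
open import Relation.Binary.PropositionalEquality using (_≡_; refl; cong; cong₂)

private
  variable
    A B : Set
    P : A → B → Set
    xs : List A
    ys : List B

take⁺ : ∀ n → Pointwise P xs ys → Pointwise P (take n xs) (take n ys)
take⁺ 0       _        = []
take⁺ (suc n) []       = []
take⁺ (suc n) (p ∷ ps) = p ∷ take⁺ n ps

drop⁺ : ∀ n → Pointwise P xs ys → Pointwise P (drop n xs) (drop n ys)
drop⁺ 0       ps       = ps
drop⁺ (suc n) []       = []
drop⁺ (suc n) (p ∷ ps) = drop⁺ n ps

Loop : Set
Loop = Gen → Maybe ℕ → Gen → Tens → Tens

-- The where-bound loop `go` of `Δch` cannot be named outside Defs; it is
-- recovered by unification against an unfolding of `Δch`, turned into a pattern
-- problem by with-abstracting the arguments. Its first argument is the (unused)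
-- argument of `Δch` it is lifted over.
loop : Loop
loop = go
  where
  go : Loop
  go = _
  unfold : ∀ i s r → Δch ((i , s) ∷ r)
                   ≡ go ((i , s) ∷ r) (just i) r (raise i nothing 0 (s ∸ 1) (Δbase (map proj₁ ((i , s) ∷ r))))
  unfold i s r with (i , s) ∷ r | just i | raise i nothing 0 (s ∸ 1) (Δbase (map proj₁ ((i , s) ∷ r)))
  ... | _ | _ | _ = refl

module Relabelling
  (R : ℕ → ℕ → Set)
  (R-functional : ∀ {a b a′ b′} → R a b → R a′ b′ → a ≡ a′ → b ≡ b′)
  (R-injective  : ∀ {a b a′ b′} → R a b → R a′ b′ → b ≡ b′ → a ≡ a′)
  where

  _∼ᵍ_ : Gen → Gen → Set
  _∼ᵍ_ = Pointwise (R ×ʳ _≡_)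

  _∼ˡ_ : Lin → Lin → Set
  _∼ˡ_ = Pointwise (_≡_ ×ʳ _∼ᵍ_)

  _∼ᵗ_ : Tens → Tens → Set
  _∼ᵗ_ = Pointwise (_≡_ ×ʳ (_∼ᵍ_ ×ʳ _∼ᵍ_))

  _∼ᵐ_ : Maybe ℕ → Maybe ℕ → Set
  _∼ᵐ_ = Maybeʷ.Pointwise R

  ≟-cong : ∀ {i j a b} → R i j → R a b → ⌊ i ≟ a ⌋ ≡ ⌊ j ≟ b ⌋
  ≟-cong {i} {j} {a} {b} i∼j a∼b with i ≟ a | j ≟ b
  ... | yes _   | yes _   = refl
  ... | no _    | no _    = refl
  ... | yes i≡a | no j≢b  = contradiction (R-functional i∼j a∼b i≡a) j≢b
  ... | no i≢a  | yes j≡b = contradiction (R-injective i∼j a∼b j≡b) i≢a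

  memb-cong : ∀ {i j g h} → R i j → g ∼ᵍ h → memb i g ≡ memb j h
  memb-cong i∼j []               = refl
  memb-cong i∼j ((a∼b , _) ∷ g∼h) = cong₂ _∨_ (≟-cong i∼j a∼b) (memb-cong i∼j g∼h)

  -- The mixed yes/no cases are refuted by the third with-argument.
  ∂-cong : ∀ {i j g h} → R i j → g ∼ᵍ h → ∂ i g ∼ˡ ∂ j h
  ∂-cong i∼j [] = []
  ∂-cong {i} {j} {(a , s) ∷ g} {(b , s) ∷ h} i∼j ((a∼b , refl) ∷ g∼h)
    with i ≟ a | j ≟ b | ≟-cong i∼j a∼b
  ... | yes _ | yes _ | _ = (refl , (a∼b , refl) ∷ g∼h) ∷ []
  ... | no _  | no _  | _ rewrite memb-cong i∼j g∼h with memb j h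
  ...   | false = []
  ...   | true  = (refl , (a∼b , refl) ∷ g∼h)
                ∷ map⁺ _ _ (Listʷ.map (λ (e , g′∼h′) → e , (a∼b , refl) ∷ g′∼h′) (∂-cong i∼j g∼h))

  negL-cong : ∀ {X Y} → X ∼ˡ Y → negL X ∼ˡ negL Y
  negL-cong = map⁺ _ _ ∘ Listʷ.map (λ (e , g∼h) → cong -_ e , g∼h)

  d-cong : ∀ {a b p q g h} → R a b → p ∼ᵐ q → g ∼ᵍ h → d a p g ∼ˡ d b q h
  d-cong a∼b Maybeʷ.nothing      g∼h = ∂-cong a∼b g∼h
  d-cong a∼b (Maybeʷ.just p∼q) g∼h = ++⁺ (∂-cong a∼b g∼h) (negL-cong (∂-cong p∼q g∼h))

  L-cong : ∀ {a b p q X Y} → R a b → p ∼ᵐ q → X ∼ᵗ Y → L a p X ∼ᵗ L b q Y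
  L-cong a∼b p∼q [] = []
  L-cong a∼b p∼q ((e , g∼g′ , h∼h′) ∷ X∼Y) =
    ++⁺ (++⁺ (map⁺ _ _ (Listʷ.map (λ (e′ , h∼) → cong₂ _*_ e e′ , g∼g′ , h∼) (d-cong a∼b p∼q h∼h′)))
             (map⁺ _ _ (Listʷ.map (λ (e′ , g∼) → cong₂ _*_ e e′ , g∼ , h∼h′) (d-cong a∼b p∼q g∼g′))))
        (L-cong a∼b p∼q X∼Y)

  scale-cong : ∀ z {X Y} → X ∼ᵗ Y → scale z X ∼ᵗ scale z Y
  scale-cong z = map⁺ _ _ ∘ Listʷ.map (λ (e , g⊗h∼) → cong (z *_) e , g⊗h∼)

  raise-cong : ∀ {a b p q} t n {X Y} → R a b → p ∼ᵐ q → X ∼ᵗ Y →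
               raise a p t n X ∼ᵗ raise b q t n Y
  raise-cong t 0       a∼b p∼q X∼Y = X∼Y
  raise-cong t (suc n) a∼b p∼q X∼Y =
    raise-cong (suc t) n a∼b p∼q (scale-cong (+ 1 / suc t) (L-cong a∼b p∼q X∼Y))

  Δbase-cong : ∀ {is js} → Pointwise R is js → Δbase is ∼ᵗ Δbase js
  Δbase-cong {is} {js} is∼js rewrite Pointwise-length is∼js = split-cong (upTo (suc (length js)))
    where
    split : List ℕ → ℕ → ℚ × Gen × Gen
    split ks n = 1ℚ , take n (map (λ i → (i , 1)) ks) , drop n (map (λ i → (i , 1)) ks)

    ones : map (λ i → (i , 1)) is ∼ᵍ map (λ i → (i , 1)) js
    ones = map⁺ _ _ (Listʷ.map (_, refl) is∼js)

    split-cong : ∀ ns → map (split is) ns ∼ᵗ map (split js) ns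
    split-cong []       = []
    split-cong (n ∷ ns) = (refl , take⁺ n ones , drop⁺ n ones) ∷ split-cong ns

  loop-cong : ∀ g₀ h₀ {p q g h X Y} → p ∼ᵐ q → g ∼ᵍ h → X ∼ᵗ Y →
              loop g₀ p g X ∼ᵗ loop h₀ q h Y
  loop-cong g₀ h₀ p∼q []                  X∼Y = X∼Y
  loop-cong g₀ h₀ {g = (_ , s) ∷ _} p∼q ((a∼b , refl) ∷ g∼h) X∼Y =
    loop-cong g₀ h₀ (Maybeʷ.just a∼b) g∼h (raise-cong 0 (s ∸ 1) a∼b p∼q X∼Y)

  Δch-cong : ∀ {g h} → g ∼ᵍ h → Δch g ∼ᵗ Δch h
  Δch-cong {g} {h} g∼h =
    loop-cong g h Maybeʷ.nothing g∼h (Δbase-cong (map⁺ _ _ (Listʷ.map proj₁ g∼h)))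

  Φ-cong : ∀ {k} (is js ss : Vec ℕ k) → (∀ m → R (lookup is m) (lookup js m)) →
           Φ is ss ∼ᵍ Φ js ss
  Φ-cong []       []       []       is∼js = []
  Φ-cong (_ ∷ is) (_ ∷ js) (_ ∷ ss) is∼js = (is∼js zero , refl) ∷ Φ-cong is js ss (is∼js ∘ suc)

  π-cong : ∀ {g h} → g ∼ᵍ h → π g ≡ π h
  π-cong = Pointwise-≡⇒≡ ∘ map⁺ _ _ ∘ Listʷ.map proj₂

  π⊗π-cong : ∀ {X Y} → X ∼ᵗ Y → π⊗π X ≡ π⊗π Y
  π⊗π-cong = Pointwise-≡⇒≡ ∘ map⁺ _ _ ∘ Listʷ.map
    λ (e , g∼g′ , h∼h′) → cong₂ _,_ e (cong₂ _,_ (π-cong g∼g′) (π-cong h∼h′))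

data Aligned {k} (is js : Vec ℕ k) : ℕ → ℕ → Set where
  at : ∀ m → Aligned is js (lookup is m) (lookup js m)

aligned-sym : ∀ {k} {is js : Vec ℕ k} {a b} → Aligned is js a b → Aligned js is b a
aligned-sym (at m) = at m

aligned-functional : ∀ {k} {is js : Vec ℕ k} → Unique is →
                     ∀ {a b a′ b′} → Aligned is js a b → Aligned is js a′ b′ → a ≡ a′ → b ≡ b′
aligned-functional uniq (at m) (at m′) is[m]≡is[m′] with lookup-injective uniq m m′ is[m]≡is[m′]
... | refl = refl

lemma4p6 : (k : ℕ) → 1 ≤ k → (ss : Vec ℕ k) → All (1 ≤_) ss →
           (is js : Vec ℕ k) →
           All (1 ≤_) is → Unique is → All (1 ≤_) js → Unique js →
           π⊗π (Δch (Φ is ss)) ≈H π⊗π (Δch (Φ js ss))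
lemma4p6 k _ ss _ is js _ uniq-is _ uniq-js a b =
  cong (coeff a b) (π⊗π-cong (Δch-cong (Φ-cong is js ss at)))
  where
  open Relabelling (Aligned is js) (aligned-functional uniq-is)
    (λ p q → aligned-functional uniq-js (aligned-sym p) (aligned-sym q))
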